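{- Let $\mathcal D=(h_1,\dots,h_{t+1})$ be a complete diagram of height $r$. Then (i) $h_1\ge r-1$, and $h_1=r$ if $r$ is even; (ii) $h_{t+1}\ge r-1$, and $h_{t+1}=r$ if $r$ is odd.
   Context: A diagram of order $t+1$ is a tuple $(h_1,\dots,h_{t+1})$ of non-negative integers, pictured as columns $C_1,\dots,C_{t+1}$ of unit blocks ($C_i$ of height $h_i$); its height is $\max_ih_i$. Two distinct columns of height $\ge s$ are neighbours at level $s$ if every column strictly between them has height $<s$. A column is left (resp. right) extremal if it has no neighbour to its left (resp. right) at level equal to its own height. Boundary conditions: every left extremal column has even height or height equal to that of the diagram; every right extremal column has odd height or height equal to that of the diagram. All diagrams satisfy them. Adjoining a domino: adding two blocks on top of a column of height $i$; the domino is even/odd as $i$ is even/odd, and left (resp. right) if in the new diagram the enlarged column is the left (resp. right) neighbour at levels $i+1,i+2$ of a column of height $\ge i+2$. A diagram is complete if no left even or right odd domino can be adjoined to it (keeping the boundary conditions). -}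

module Defs where

open import Data.Nat using (ℕ; zero; suc; _+_; _≤_; _<_; _⊔_)
open import Data.Nat.Divisibility using (_∣_)
open import Data.Fin using (Fin; zero; suc; _≟_)
import Data.Fin as F
open import Data.Product using (_×_; ∃-syntax)
open import Data.Sum using (_⊎_)
open import Relation.Nullary using (¬_; yes; no)
open import Relation.Binary.PropositionalEquality using (_≡_)

-- A diagram of order t+1: column heights h : Fin (suc t) → ℕ
-- (column C_{i+1} of the paper is index i).

Even : ℕ → Set
Even n = 2 ∣ n

Odd : ℕ → Set
Odd n = ¬ Even n

height : ∀ {t} → (Fin (suc t) → ℕ) → ℕ
height {zero}  h = h zero
height {suc t} h = h zero ⊔ height (λ k → h (suc k))

-- i is the left neighbour of j at level s (so j is the right neighbour of i)
LeftNbrAt : ∀ {t} → (Fin (suc t) → ℕ) → ℕ → Fin (suc t) → Fin (suc t) → Set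
LeftNbrAt h s i j =
  i F.< j × s ≤ h i × s ≤ h j × (∀ k → i F.< k → k F.< j → h k < s)

LeftExtremal : ∀ {t} → (Fin (suc t) → ℕ) → Fin (suc t) → Set
LeftExtremal h i = ¬ (∃[ j ] LeftNbrAt h (h i) j i)

RightExtremal : ∀ {t} → (Fin (suc t) → ℕ) → Fin (suc t) → Set
RightExtremal h i = ¬ (∃[ j ] LeftNbrAt h (h i) i j)

Boundary : ∀ {t} → (Fin (suc t) → ℕ) → Set
Boundary h = ∀ i →
  (LeftExtremal h i → Even (h i) ⊎ h i ≡ height h) ×
  (RightExtremal h i → Odd (h i) ⊎ h i ≡ height h)

-- adjoin a domino (two blocks) on top of column c
adjoin : ∀ {t} → (Fin (suc t) → ℕ) → Fin (suc t) → (Fin (suc t) → ℕ)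
adjoin h c k with k ≟ c
... | yes _ = h c + 2
... | no  _ = h k

LeftDomino : ∀ {t} → (Fin (suc t) → ℕ) → Fin (suc t) → Set
LeftDomino h c = ∃[ j ]
  (LeftNbrAt (adjoin h c) (h c + 1) c j ×
   LeftNbrAt (adjoin h c) (h c + 2) c j ×
   h c + 2 ≤ adjoin h c j)

RightDomino : ∀ {t} → (Fin (suc t) → ℕ) → Fin (suc t) → Set
RightDomino h c = ∃[ j ]
  (LeftNbrAt (adjoin h c) (h c + 1) j c ×
   LeftNbrAt (adjoin h c) (h c + 2) j c ×
   h c + 2 ≤ adjoin h c j)

record Diagram (t : ℕ) : Set where
  field
    col      : Fin (suc t) → ℕ
    boundary : Boundary col
open Diagram public

Complete : ∀ {t} → Diagram t → Set
Complete D = ∀ c → Boundary (adjoin (col D) c) →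
  ¬ (Even (col D c) × LeftDomino (col D) c) ×
  ¬ (Odd (col D c) × RightDomino (col D) c)

module Submission where

-- Idea (left end; the right end is the mirror image with parities swapped).
-- Let a = h₁ and suppose a + 2 ≤ r.  Column C₁ is left extremal and below
-- the top, so a is even.  Let C_k be the first column taller than a.  If
-- h_k = a + 1, then C_k is left extremal, odd and below the top, violating
-- the boundary conditions.  If h_k ≥ a + 2, then a domino on C₁ is a left
-- even domino (C₁ and C_k become neighbours at levels a+1, a+2), and the new
-- diagram still satisfies the boundary conditions: only C₁ changed, it is
-- an end column, and its new height a + 2 is even.  This contradicts
-- completeness, so r ≤ a + 1; the parity statements then follow from the
-- boundary condition at the end column.

open import Defs
open import Data.Nat using (ℕ; _≤_; _∸_)
open import Data.Fin using (zero; fromℕ)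
open import Data.Product using (_×_)
open import Relation.Binary.PropositionalEquality using (_≡_)

open import Data.Nat using (suc; _+_; _<_; _<?_; z≤n; s≤s)
open import Data.Nat.Properties
  using (≤-refl; ≤-trans; ≤-antisym; ≤-total; <-≤-trans; ≤-<-trans; <⇒≱; <-irrefl; ≮⇒≥;
         n≤1+n; m≤n⇒m<n∨m≡n; m≤m⊔n; m≤n⊔m; ⊔-lub; m≤m+n; m<m+n; +-monoʳ-≤; +-comm;
         ∸-monoˡ-≤)
open import Data.Nat.Divisibility using (_∣_; _∣0; ∣-refl; ∣m∣n⇒∣m+n; ∣m+n∣m⇒∣n; ∣1⇒≡1)
open import Data.Fin using (Fin; suc; _≟_)
import Data.Fin as F
import Data.Fin.Properties as FinP
open import Data.Product using (∃; ∃-syntax; _,_; proj₁; proj₂)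
open import Data.Sum using (_⊎_; inj₁; inj₂)
open import Data.Empty using (⊥; ⊥-elim)
open import Relation.Nullary using (¬_; Dec; yes; no)
open import Relation.Unary using (Decidable)
open import Relation.Binary.PropositionalEquality using (refl; sym; trans; subst; subst₂; _≢_)

even-2+ : ∀ {n} → Even n → Even (2 + n)
even-2+ e = ∣m∣n⇒∣m+n ∣-refl e

odd-2+ : ∀ {n} → Odd n → Odd (2 + n)
odd-2+ o e = o (∣m+n∣m⇒∣n e ∣-refl)

even⇒odd-suc : ∀ {n} → Even n → Odd (suc n)
even⇒odd-suc {n} e e′ with ∣1⇒≡1 (∣m+n∣m⇒∣n (subst (2 ∣_) (+-comm 1 n) e′) e)
... | ()

parity : ∀ n → Even n ⊎ Even (suc n)
parity 0 = inj₁ (2 ∣0)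
parity (suc n) with parity n
... | inj₁ e = inj₂ (even-2+ e)
... | inj₂ e = inj₁ e

odd⇒even-suc : ∀ {n} → Odd n → Even (suc n)
odd⇒even-suc {n} o with parity n
... | inj₁ e = ⊥-elim (o e)
... | inj₂ e = e

column≤height : ∀ {t} (h : Fin (suc t) → ℕ) k → h k ≤ height h
column≤height {0} h zero = ≤-refl
column≤height {suc t} h zero = m≤m⊔n (h zero) _
column≤height {suc t} h (suc k) =
  ≤-trans (column≤height (λ i → h (suc i)) k) (m≤n⊔m (h zero) _)

height≤ : ∀ {t} (h : Fin (suc t) → ℕ) {M} → (∀ k → h k ≤ M) → height h ≤ M
height≤ {0} h bound = bound zero
height≤ {suc t} h bound =
  ⊔-lub (bound zero) (height≤ (λ i → h (suc i)) (λ i → bound (suc i)))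

tallest : ∀ {t} (h : Fin (suc t) → ℕ) → ∃[ j ] (height h ≤ h j)
tallest {0} h = zero , ≤-refl
tallest {suc t} h with ≤-total (h zero) (height (λ i → h (suc i)))
... | inj₂ rest≤h0 = zero , ⊔-lub ≤-refl rest≤h0
... | inj₁ h0≤rest with tallest (λ i → h (suc i))
...   | j , rest≤hj = suc j , ⊔-lub (≤-trans h0≤rest rest≤hj) rest≤hj

-- An end column is never strictly between two columns, so adjoining a
-- domino on it cannot separate neighbours.

EndColumn : ∀ {t} → Fin (suc t) → Set
EndColumn {t} c = ∀ (x k y : Fin (suc t)) → x F.< k → k F.< y → k ≢ c

first-end : ∀ {t} → EndColumn {t} zero
first-end x .zero y () _ refl

last-end : ∀ {t} → EndColumn (fromℕ t)
last-end x k y _ k<y refl = <⇒≱ k<y (FinP.≤fromℕ y)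

first-leftExtremal : ∀ {t} (h : Fin (suc t) → ℕ) → LeftExtremal h zero
first-leftExtremal h (_ , () , _)

last-rightExtremal : ∀ {t} (h : Fin (suc t) → ℕ) → RightExtremal h (fromℕ t)
last-rightExtremal h (j , last<j , _) = <⇒≱ last<j (FinP.≤fromℕ j)

shelter-left : ∀ {t} (h : Fin (suc t) → ℕ) k → (∀ m → m F.< k → h m < h k) →
  LeftExtremal h k
shelter-left h k lower (m , m<k , hk≤hm , _) = <⇒≱ (lower m m<k) hk≤hm

shelter-right : ∀ {t} (h : Fin (suc t) → ℕ) k → (∀ m → k F.< m → h m < h k) →
  RightExtremal h k
shelter-right h k lower (m , k<m , _ , hk≤hm , _) = <⇒≱ (lower m k<m) hk≤hm

leftExtremal-even : ∀ {t} {h : Fin (suc t) → ℕ} → Boundary h → ∀ {k} →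
  LeftExtremal h k → h k < height h → Even (h k)
leftExtremal-even B {k} ext below with proj₁ (B k) ext
... | inj₁ e = e
... | inj₂ top = ⊥-elim (<-irrefl top below)

rightExtremal-odd : ∀ {t} {h : Fin (suc t) → ℕ} → Boundary h → ∀ {k} →
  RightExtremal h k → h k < height h → Odd (h k)
rightExtremal-odd B {k} ext below with proj₂ (B k) ext
... | inj₁ o = o
... | inj₂ top = ⊥-elim (<-irrefl top below)

adjoin-at : ∀ {t} (h : Fin (suc t) → ℕ) c → adjoin h c c ≡ h c + 2
adjoin-at h c with c ≟ c
... | yes _ = refl
... | no c≢c = ⊥-elim (c≢c refl)

adjoin-off : ∀ {t} (h : Fin (suc t) → ℕ) c {k} → k ≢ c → adjoin h c k ≡ h k
adjoin-off h c {k} k≢c with k ≟ c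
... | yes k≡c = ⊥-elim (k≢c k≡c)
... | no _ = refl

adjoin-≥ : ∀ {t} (h : Fin (suc t) → ℕ) c k → h k ≤ adjoin h c k
adjoin-≥ h c k with k ≟ c
... | yes refl = m≤m+n (h k) 2
... | no _ = ≤-refl

adjoin-height : ∀ {t} (h : Fin (suc t) → ℕ) c → h c + 2 ≤ height h →
  height (adjoin h c) ≡ height h
adjoin-height h c room = ≤-antisym (height≤ (adjoin h c) fits) reached
  where
  fits : ∀ k → adjoin h c k ≤ height h
  fits k with k ≟ c
  ... | yes refl = room
  ... | no _ = column≤height h k
  j : Fin _
  j = proj₁ (tallest h)
  reached : height h ≤ height (adjoin h c)
  reached = ≤-trans (proj₂ (tallest h))
              (≤-trans (adjoin-≥ h c j) (column≤height (adjoin h c) j))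

adjoin-nbr : ∀ {t} (h : Fin (suc t) → ℕ) c s {x y} → x F.< y →
  s ≤ adjoin h c x → s ≤ adjoin h c y →
  (∀ k → x F.< k → k F.< y → k ≢ c) → (∀ k → x F.< k → k F.< y → h k < s) →
  LeftNbrAt (adjoin h c) s x y
adjoin-nbr h c s x<y sx sy avoid low =
  x<y , sx , sy ,
  λ k x<k k<y → subst (_< s) (sym (adjoin-off h c (avoid k x<k k<y))) (low k x<k k<y)

adjoin-keeps-nbr : ∀ {t} (h : Fin (suc t) → ℕ) c → EndColumn c → ∀ s {x y} →
  LeftNbrAt h s x y → LeftNbrAt (adjoin h c) s x y
adjoin-keeps-nbr h c end s (x<y , sx , sy , low) =
  adjoin-nbr h c s x<y (≤-trans sx (adjoin-≥ h c _)) (≤-trans sy (adjoin-≥ h c _))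
    (λ k → end _ k _) low

-- Adjoining a domino on an end column without changing the height
-- preserves the boundary conditions as soon as they hold at that column:
-- every other column keeps its height and all its neighbours, so a column
-- extremal in the new diagram was already extremal (at the same height).
adjoin-boundary : ∀ {t} (h : Fin (suc t) → ℕ) c → Boundary h → EndColumn c →
  height (adjoin h c) ≡ height h →
  (LeftExtremal (adjoin h c) c → Even (adjoin h c c) ⊎ adjoin h c c ≡ height (adjoin h c)) ×
  (RightExtremal (adjoin h c) c → Odd (adjoin h c c) ⊎ adjoin h c c ≡ height (adjoin h c)) →
  Boundary (adjoin h c)
adjoin-boundary h c B end same atC i = by-column (i ≟ c)
  where
  h′ : Fin _ → ℕ
  h′ = adjoin h c
  Conditions : Fin _ → Set
  Conditions k = (LeftExtremal h′ k → Even (h′ k) ⊎ h′ k ≡ height h′) ×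
                 (RightExtremal h′ k → Odd (h′ k) ⊎ h′ k ≡ height h′)
  other : i ≢ c → Conditions i
  other i≢c =
    (λ ext → carry Even (proj₁ (B i) (λ (m , nbr) → ext (m , lift nbr)))) ,
    (λ ext → carry Odd (proj₂ (B i) (λ (m , nbr) → ext (m , lift nbr))))
    where
    unchanged : h′ i ≡ h i
    unchanged = adjoin-off h c i≢c
    lift : ∀ {x y} → LeftNbrAt h (h i) x y → LeftNbrAt h′ (h′ i) x y
    lift {x} {y} nbr =
      subst (λ s → LeftNbrAt h′ s x y) (sym unchanged) (adjoin-keeps-nbr h c end (h i) nbr)
    carry : (P : ℕ → Set) → P (h i) ⊎ h i ≡ height h → P (h′ i) ⊎ h′ i ≡ height h′
    carry P = subst₂ (λ v w → P v ⊎ v ≡ w) (sym unchanged) (sym same)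
  by-column : Dec (i ≡ c) → Conditions i
  by-column (yes i≡c) = subst Conditions (sym i≡c) atC
  by-column (no i≢c) = other i≢c

first-witness : ∀ {n} {P : Fin n → Set} → Decidable P → ∃ P →
  ∃[ k ] (P k × (∀ m → m F.< k → ¬ P m))
first-witness {suc n} P? (j , pj) with P? zero
... | yes p0 = zero , p0 , λ _ ()
first-witness {suc n} P? (zero , p0) | no ¬p0 = ⊥-elim (¬p0 p0)
first-witness {suc n} {P} P? (suc j , pj) | no ¬p0
  with first-witness (λ k → P? (suc k)) (j , pj)
... | k , pk , before = suc k , pk , earlier
  where
  earlier : ∀ m → m F.< suc k → ¬ P m
  earlier zero _ = ¬p0
  earlier (suc m) (s≤s m<k) = before m m<k

last-witness : ∀ {n} {P : Fin n → Set} → Decidable P → ∃ P →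
  ∃[ k ] (P k × (∀ m → k F.< m → ¬ P m))
last-witness {suc n} {P} P? (j , pj) with FinP.any? (λ k → P? (suc k))
... | yes later with last-witness (λ k → P? (suc k)) later
...   | k , pk , after = suc k , pk , beyond
  where
  beyond : ∀ m → suc k F.< m → ¬ P m
  beyond (suc m) (s≤s k<m) = after m k<m
last-witness {suc n} {P} P? (zero , p0) | no none = zero , p0 , beyond
  where
  beyond : ∀ (m : Fin (suc n)) → zero {n} F.< m → ¬ P m
  beyond (suc m) _ pm = none (m , pm)
last-witness {suc n} P? (suc j , pj) | no none = ⊥-elim (none (j , pj))

first-domino-fits : ∀ {t} (h : Fin (suc t) → ℕ) → Boundary h → Even (h zero) →
  h zero + 2 ≤ height h → ∀ k → h zero + 2 ≤ h k → (∀ m → m F.< k → h m ≤ h zero) →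
  Boundary (adjoin h zero) × LeftDomino h zero
first-domino-fits {t} h B even room k high before =
  still-boundary ,
  (k , nbr (a + 1) (m<m+n a (s≤s z≤n)) (+-monoʳ-≤ a (n≤1+n 1)) ,
       nbr (a + 2) a<a+2 ≤-refl ,
       subst (a + 2 ≤_) (sym (adjoin-off h zero k≢first)) high)
  where
  a : ℕ
  a = h zero
  h′ : Fin _ → ℕ
  h′ = adjoin h zero
  a<a+2 : a < a + 2
  a<a+2 = m<m+n a (s≤s z≤n)
  k≢first : k ≢ zero
  k≢first refl = <⇒≱ a<a+2 high
  first<k : zero {t} F.< k
  first<k = FinP.≤∧≢⇒< z≤n (λ first≡k → k≢first (sym first≡k))
  nbr : ∀ s → a < s → s ≤ a + 2 → LeftNbrAt h′ s zero k
  nbr s a<s s≤a+2 =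
    adjoin-nbr h zero s first<k
      (subst (s ≤_) (sym (adjoin-at h zero)) s≤a+2)
      (subst (s ≤_) (sym (adjoin-off h zero k≢first)) (≤-trans s≤a+2 high))
      (λ m → first-end zero m k) (λ m _ m<k → ≤-<-trans (before m m<k) a<s)
  still-boundary : Boundary h′
  still-boundary =
    adjoin-boundary h zero B first-end (adjoin-height h zero room)
      ((λ _ → inj₁ (subst Even (sym (trans (adjoin-at h zero) (+-comm a 2))) (even-2+ even))) ,
       (λ ext → ⊥-elim (ext (k , subst (λ s → LeftNbrAt h′ s zero k) (sym (adjoin-at h zero))
                                        (nbr (a + 2) a<a+2 ≤-refl)))))

last-domino-fits : ∀ {t} (h : Fin (suc t) → ℕ) → Boundary h → Odd (h (fromℕ t)) →
  h (fromℕ t) + 2 ≤ height h → ∀ k → h (fromℕ t) + 2 ≤ h k →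
  (∀ m → k F.< m → h m ≤ h (fromℕ t)) →
  Boundary (adjoin h (fromℕ t)) × RightDomino h (fromℕ t)
last-domino-fits {t} h B odd room k high after =
  still-boundary ,
  (k , nbr (b + 1) (m<m+n b (s≤s z≤n)) (+-monoʳ-≤ b (n≤1+n 1)) ,
       nbr (b + 2) b<b+2 ≤-refl ,
       subst (b + 2 ≤_) (sym (adjoin-off h last k≢last)) high)
  where
  last : Fin (suc t)
  last = fromℕ t
  b : ℕ
  b = h last
  h′ : Fin _ → ℕ
  h′ = adjoin h last
  b<b+2 : b < b + 2
  b<b+2 = m<m+n b (s≤s z≤n)
  k≢last : k ≢ last
  k≢last refl = <⇒≱ b<b+2 high
  k<last : k F.< last
  k<last = FinP.≤∧≢⇒< (FinP.≤fromℕ k) k≢last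
  nbr : ∀ s → b < s → s ≤ b + 2 → LeftNbrAt h′ s k last
  nbr s b<s s≤b+2 =
    adjoin-nbr h last s k<last
      (subst (s ≤_) (sym (adjoin-off h last k≢last)) (≤-trans s≤b+2 high))
      (subst (s ≤_) (sym (adjoin-at h last)) s≤b+2)
      (λ m → last-end k m last) (λ m k<m _ → ≤-<-trans (after m k<m) b<s)
  still-boundary : Boundary h′
  still-boundary =
    adjoin-boundary h last B last-end (adjoin-height h last room)
      ((λ ext → ⊥-elim (ext (k , subst (λ s → LeftNbrAt h′ s k last) (sym (adjoin-at h last))
                                        (nbr (b + 2) b<b+2 ≤-refl)))) ,
       (λ _ → inj₁ (subst Odd (sym (trans (adjoin-at h last) (+-comm b 2))) (odd-2+ odd))))

-- If it
-- were two below, the first column C_k taller than it either exceeds it by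
-- one (then C_k is left extremal of odd height below the top) or by two
-- (then a left even domino fits), both impossible.
first-column-near-top : ∀ {t} (D : Diagram t) → Complete D →
  height (col D) ≤ suc (col D zero)
first-column-near-top D complete = ≮⇒≥ two-below
  where
  h : Fin _ → ℕ
  h = col D
  a : ℕ
  a = h zero
  two-below : ¬ (suc a < height h)
  two-below a+1<r = step (first-witness (λ m → a <? h m) (j , <-≤-trans a<r r≤hj))
    where
    a<r : a < height h
    a<r = ≤-trans (n≤1+n (suc a)) a+1<r
    j : Fin _
    j = proj₁ (tallest h)
    r≤hj : height h ≤ h j
    r≤hj = proj₂ (tallest h)
    even : Even a
    even = leftExtremal-even (boundary D) (first-leftExtremal h) a<r
    step : ∃[ k ] (a < h k × (∀ m → m F.< k → ¬ a < h m)) → ⊥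
    step (k , a<hk , before) with m≤n⇒m<n∨m≡n a<hk
    ... | inj₂ a+1≡hk =
      even⇒odd-suc even (subst Even (sym a+1≡hk)
        (leftExtremal-even (boundary D)
          (shelter-left h k (λ m m<k → ≤-<-trans (≮⇒≥ (before m m<k)) a<hk))
          (subst (_< height h) a+1≡hk a+1<r)))
    ... | inj₁ a+1<hk =
      refute (first-domino-fits h (boundary D) even (subst (_≤ height h) (+-comm 2 a) a+1<r)
                k (subst (_≤ h k) (+-comm 2 a) a+1<hk) (λ m m<k → ≮⇒≥ (before m m<k)))
      where
      refute : Boundary (adjoin h zero) × LeftDomino h zero → ⊥
      refute (fits , domino) = proj₁ (complete zero fits) (even , domino)

last-column-near-top : ∀ {t} (D : Diagram t) → Complete D →
  height (col D) ≤ suc (col D (fromℕ t))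
last-column-near-top {t} D complete = ≮⇒≥ two-below
  where
  h : Fin _ → ℕ
  h = col D
  b : ℕ
  b = h (fromℕ t)
  two-below : ¬ (suc b < height h)
  two-below b+1<r = step (last-witness (λ m → b <? h m) (j , <-≤-trans b<r r≤hj))
    where
    b<r : b < height h
    b<r = ≤-trans (n≤1+n (suc b)) b+1<r
    j : Fin _
    j = proj₁ (tallest h)
    r≤hj : height h ≤ h j
    r≤hj = proj₂ (tallest h)
    odd : Odd b
    odd = rightExtremal-odd (boundary D) (last-rightExtremal h) b<r
    step : ∃[ k ] (b < h k × (∀ m → k F.< m → ¬ b < h m)) → ⊥
    step (k , b<hk , after) with m≤n⇒m<n∨m≡n b<hk
    ... | inj₂ b+1≡hk =
      rightExtremal-odd (boundary D)
        (shelter-right h k (λ m k<m → ≤-<-trans (≮⇒≥ (after m k<m)) b<hk))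
        (subst (_< height h) b+1≡hk b+1<r)
        (subst Even b+1≡hk (odd⇒even-suc odd))
    ... | inj₁ b+1<hk =
      refute (last-domino-fits h (boundary D) odd (subst (_≤ height h) (+-comm 2 b) b+1<r)
                k (subst (_≤ h k) (+-comm 2 b) b+1<hk) (λ m k<m → ≮⇒≥ (after m k<m)))
      where
      refute : Boundary (adjoin h (fromℕ t)) × RightDomino h (fromℕ t) → ⊥
      refute (fits , domino) = proj₂ (complete (fromℕ t) fits) (odd , domino)

top-or-below : ∀ {a r} → a ≤ r → r ≤ suc a → a ≡ r ⊎ suc a ≡ r
top-or-below a≤r r≤a+1 with m≤n⇒m<n∨m≡n a≤r
... | inj₁ a<r = inj₂ (≤-antisym a<r r≤a+1)
... | inj₂ a≡r = inj₁ a≡r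

first-column : ∀ {t} (D : Diagram t) → Complete D →
  height (col D) ∸ 1 ≤ col D zero × (Even (height (col D)) → col D zero ≡ height (col D))
first-column D complete = ∸-monoˡ-≤ 1 near , at-top
  where
  near : height (col D) ≤ suc (col D zero)
  near = first-column-near-top D complete
  at-top : Even (height (col D)) → col D zero ≡ height (col D)
  at-top even-r with top-or-below (column≤height (col D) zero) near
  ... | inj₁ top = top
  ... | inj₂ a+1≡r = ⊥-elim (
    even⇒odd-suc
      (leftExtremal-even (boundary D) (first-leftExtremal (col D)) (subst (col D zero <_) a+1≡r ≤-refl))
      (subst Even (sym a+1≡r) even-r))

last-column : ∀ {t} (D : Diagram t) → Complete D →
  height (col D) ∸ 1 ≤ col D (fromℕ t) ×
  (Odd (height (col D)) → col D (fromℕ t) ≡ height (col D))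
last-column {t} D complete = ∸-monoˡ-≤ 1 near , at-top
  where
  near : height (col D) ≤ suc (col D (fromℕ t))
  near = last-column-near-top D complete
  at-top : Odd (height (col D)) → col D (fromℕ t) ≡ height (col D)
  at-top odd-r with top-or-below (column≤height (col D) (fromℕ t)) near
  ... | inj₁ top = top
  ... | inj₂ b+1≡r = ⊥-elim (
    odd-r (subst Even b+1≡r (odd⇒even-suc
      (rightExtremal-odd (boundary D) (last-rightExtremal (col D))
        (subst (col D (fromℕ t) <_) b+1≡r ≤-refl)))))

lemma2p3p2 : ∀ (t : ℕ) (D : Diagram t) → Complete D →
    (height (col D) ∸ 1 ≤ col D zero ×
      (Even (height (col D)) → col D zero ≡ height (col D))) ×
    (height (col D) ∸ 1 ≤ col D (fromℕ t) ×
      (Odd (height (col D)) → col D (fromℕ t) ≡ height (col D)))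
lemma2p3p2 t D complete = first-column D complete , last-column D complete
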